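{- For all integers $d$ and $0\le m\le d$, there are mappings $\varphi^x_{d,m},\varphi^y_{d,m}:\{0,1\}^d\to\{0,1\}^{O(d^2)}$ and an integer $M_d$ such that for all $x,y\in\{0,1\}^d$: if $\langle x,y\rangle=m$ then $\langle\varphi^x_{d,m}(x),\varphi^y_{d,m}(y)\rangle=M_d$, and otherwise $\langle\varphi^x_{d,m}(x),\varphi^y_{d,m}(y)\rangle>M_d$. -}

module Defs where

open import Data.Bool using (Bool; true; false; _∧_)
open import Data.Nat using (ℕ; zero; suc; _+_)
open import Data.Vec using (Vec; []; _∷_)

BitVec : ℕ → Set
BitVec d = Vec Bool d

bit : Bool → ℕ
bit true  = 1
bit false = 0

⟨_,_⟩ : ∀ {n} → BitVec n → BitVec n → ℕ
⟨ [] , [] ⟩ = 0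
⟨ a ∷ x , b ∷ y ⟩ = bit (a ∧ b) + ⟨ x , y ⟩

-- Encode ⟨x,y⟩ into a vector inner product
--   p² + 2m(d − p) + (d − m)² = d² + (p − m)²,   p = ⟨x,y⟩,
-- which equals d² exactly when p = m and exceeds it otherwise. Each summand is
-- an inner product of explicit vectors: p² from the tensor square x ⊗ x,
-- d − p from a complement gadget, and the constant (d − m)² from padding by ones.
module Submission where

open import Defs
open import Data.Nat using (ℕ; _≤_; _*_; _^_; _>_)
open import Data.Product using (Σ; ∃; ∃-syntax; _×_)
open import Relation.Binary.PropositionalEquality using (_≡_)
open import Relation.Nullary using (¬_)

open import Data.Bool using (true; false; _∧_; not)
open import Data.Bool.Properties using (∧-zeroʳ)
open import Data.Nat using (zero; suc; _+_; _∸_; ∣_-_∣; _<_)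
open import Data.Nat.Properties
open import Data.Nat.Tactic.RingSolver using (solve-∀)
open import Data.Product using (_,_)
open import Data.Sum using ([_,_]′)
open import Data.Vec using ([]; _∷_; _++_; map; replicate)
open import Relation.Binary.PropositionalEquality
  using (refl; sym; trans; cong; cong₂; subst; module ≡-Reasoning)
open import Relation.Nullary using (contraposition)

ones : ∀ d → BitVec d
ones d = replicate d true

⟨⟩-ones : ∀ d → ⟨ ones d , ones d ⟩ ≡ d
⟨⟩-ones zero    = refl
⟨⟩-ones (suc d) = cong suc (⟨⟩-ones d)

⟨⟩-++ : ∀ {a b} (x : BitVec a) (x′ : BitVec b) y y′ →
        ⟨ x ++ x′ , y ++ y′ ⟩ ≡ ⟨ x , y ⟩ + ⟨ x′ , y′ ⟩
⟨⟩-++ []      x′ []      y′ = refl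
⟨⟩-++ (a ∷ x) x′ (b ∷ y) y′ =
  trans (cong (bit (a ∧ b) +_) (⟨⟩-++ x x′ y y′)) (sym (+-assoc (bit (a ∧ b)) _ _))

_⊗_ : ∀ {a b} → BitVec a → BitVec b → BitVec (a * b)
[]      ⊗ v = []
(a ∷ x) ⊗ v = map (a ∧_) v ++ (x ⊗ v)

bit-∧-interchange : ∀ a b c e → bit ((a ∧ c) ∧ (b ∧ e)) ≡ bit (a ∧ b) * bit (c ∧ e)
bit-∧-interchange true  true  c e = sym (+-identityʳ (bit (c ∧ e)))
bit-∧-interchange true  false c e = cong bit (∧-zeroʳ c)
bit-∧-interchange false b     c e = refl

⟨⟩-map-∧ : ∀ {n} a b (v w : BitVec n) →
           ⟨ map (a ∧_) v , map (b ∧_) w ⟩ ≡ bit (a ∧ b) * ⟨ v , w ⟩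
⟨⟩-map-∧ a b []      []      = sym (*-zeroʳ (bit (a ∧ b)))
⟨⟩-map-∧ a b (c ∷ v) (e ∷ w) = begin
  bit ((a ∧ c) ∧ (b ∧ e)) + ⟨ map (a ∧_) v , map (b ∧_) w ⟩
    ≡⟨ cong₂ _+_ (bit-∧-interchange a b c e) (⟨⟩-map-∧ a b v w) ⟩
  bit (a ∧ b) * bit (c ∧ e) + bit (a ∧ b) * ⟨ v , w ⟩
    ≡⟨ sym (*-distribˡ-+ (bit (a ∧ b)) (bit (c ∧ e)) ⟨ v , w ⟩) ⟩
  bit (a ∧ b) * (bit (c ∧ e) + ⟨ v , w ⟩) ∎
  where open ≡-Reasoning

⟨⟩-⊗ : ∀ {a b} (x : BitVec a) (x′ : BitVec b) y y′ →
       ⟨ x ⊗ x′ , y ⊗ y′ ⟩ ≡ ⟨ x , y ⟩ * ⟨ x′ , y′ ⟩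
⟨⟩-⊗ []      x′ []      y′ = refl
⟨⟩-⊗ (a ∷ x) x′ (b ∷ y) y′ = begin
  ⟨ map (a ∧_) x′ ++ (x ⊗ x′) , map (b ∧_) y′ ++ (y ⊗ y′) ⟩
    ≡⟨ ⟨⟩-++ (map (a ∧_) x′) (x ⊗ x′) (map (b ∧_) y′) (y ⊗ y′) ⟩
  ⟨ map (a ∧_) x′ , map (b ∧_) y′ ⟩ + ⟨ x ⊗ x′ , y ⊗ y′ ⟩
    ≡⟨ cong₂ _+_ (⟨⟩-map-∧ a b x′ y′) (⟨⟩-⊗ x x′ y y′) ⟩
  bit (a ∧ b) * ⟨ x′ , y′ ⟩ + ⟨ x , y ⟩ * ⟨ x′ , y′ ⟩
    ≡⟨ sym (*-distribʳ-+ ⟨ x′ , y′ ⟩ (bit (a ∧ b)) ⟨ x , y ⟩) ⟩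
  (bit (a ∧ b) + ⟨ x , y ⟩) * ⟨ x′ , y′ ⟩ ∎
  where open ≡-Reasoning

⟨⟩-not-+ : ∀ {d} (x y : BitVec d) → ⟨ map not x , y ⟩ + ⟨ x , y ⟩ ≡ ⟨ ones d , y ⟩
⟨⟩-not-+ []          []          = refl
⟨⟩-not-+ (true  ∷ x) (true  ∷ y) = trans (+-suc _ _) (cong suc (⟨⟩-not-+ x y))
⟨⟩-not-+ (true  ∷ x) (false ∷ y) = ⟨⟩-not-+ x y
⟨⟩-not-+ (false ∷ x) (b     ∷ y) = trans (+-assoc (bit b) _ _) (cong (bit b +_) (⟨⟩-not-+ x y))

⟨⟩-ones-not-+ : ∀ {d} (y : BitVec d) → ⟨ ones d , map not y ⟩ + ⟨ ones d , y ⟩ ≡ d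
⟨⟩-ones-not-+ []          = refl
⟨⟩-ones-not-+ (true  ∷ y) = trans (+-suc _ _) (cong suc (⟨⟩-ones-not-+ y))
⟨⟩-ones-not-+ (false ∷ y) = cong suc (⟨⟩-ones-not-+ y)

-- ⟨ coˣ x , coʸ y ⟩ counts the positions i with ¬ y_i, plus those with y_i ∧ ¬ x_i.
coˣ : ∀ {d} → BitVec d → BitVec (d + d)
coˣ {d} x = ones d ++ map not x

coʸ : ∀ {d} → BitVec d → BitVec (d + d)
coʸ y = map not y ++ y

⟨⟩-co-+ : ∀ {d} (x y : BitVec d) → ⟨ coˣ x , coʸ y ⟩ + ⟨ x , y ⟩ ≡ d
⟨⟩-co-+ {d} x y = begin
  ⟨ coˣ x , coʸ y ⟩ + ⟨ x , y ⟩
    ≡⟨ cong (_+ ⟨ x , y ⟩) (⟨⟩-++ (ones d) (map not x) (map not y) y) ⟩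
  ⟨ ones d , map not y ⟩ + ⟨ map not x , y ⟩ + ⟨ x , y ⟩
    ≡⟨ +-assoc ⟨ ones d , map not y ⟩ _ _ ⟩
  ⟨ ones d , map not y ⟩ + (⟨ map not x , y ⟩ + ⟨ x , y ⟩)
    ≡⟨ cong (⟨ ones d , map not y ⟩ +_) (⟨⟩-not-+ x y) ⟩
  ⟨ ones d , map not y ⟩ + ⟨ ones d , y ⟩
    ≡⟨ ⟨⟩-ones-not-+ y ⟩
  d ∎
  where open ≡-Reasoning

+-comm-within : ∀ a b c → a + (b + c) ≡ a + c + b
+-comm-within a b c = trans (cong (a +_) (+-comm b c)) (sym (+-assoc a c b))

square-completion : ∀ {d m p K K₀} → K + p ≡ d → K₀ + m ≡ d →
                    p * p + 2 * m * K + K₀ * K₀ ≡ d * d + ∣ p - m ∣ * ∣ p - m ∣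
square-completion {d} {m} {p} {K} {K₀} refl K₀+m≡K+p = [ below , above ]′ (≤-total p m)
  where
  goal : Set
  goal = p * p + 2 * m * K + K₀ * K₀ ≡ d * d + ∣ p - m ∣ * ∣ p - m ∣

  below : p ≤ m → goal
  below p≤m with k , refl ← m≤n⇒∃[o]m+o≡n p≤m
            with refl ← +-cancelʳ-≡ p K (K₀ + k) (trans (sym K₀+m≡K+p) (+-comm-within K₀ p k))
            rewrite ∣m-m+n∣≡n p k = identity p k K₀
    where
    identity : ∀ p k K₀ → p * p + 2 * (p + k) * (K₀ + k) + K₀ * K₀
                          ≡ (K₀ + k + p) * (K₀ + k + p) + k * k
    identity = solve-∀

  above : m ≤ p → goal
  above m≤p with k , refl ← m≤n⇒∃[o]m+o≡n m≤p
            with refl ← +-cancelʳ-≡ m K₀ (K + k) (trans K₀+m≡K+p (+-comm-within K m k))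
            rewrite ∣-∣-comm (m + k) m | ∣m-m+n∣≡n m k = identity m k K
    where
    identity : ∀ m k K → (m + k) * (m + k) + 2 * m * K + (K + k) * (K + k)
                         ≡ (K + (m + k)) * (K + (m + k)) + k * k
    identity = solve-∀

encodingLength : ℕ → ℕ → ℕ
encodingLength d m = d * d + (2 * m * (d + d) + (d ∸ m) * (d ∸ m))

φˣ : ∀ {d} m → BitVec d → BitVec (encodingLength d m)
φˣ {d} m x = (x ⊗ x) ++ ((ones (2 * m) ⊗ coˣ x) ++ ones ((d ∸ m) * (d ∸ m)))

φʸ : ∀ {d} m → BitVec d → BitVec (encodingLength d m)
φʸ {d} m y = (y ⊗ y) ++ ((ones (2 * m) ⊗ coʸ y) ++ ones ((d ∸ m) * (d ∸ m)))

encodingLength-≤ : ∀ {d m} → m ≤ d → encodingLength d m ≤ 6 * d ^ 2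
encodingLength-≤ {d} {m} m≤d = begin
  d * d + (2 * m * (d + d) + (d ∸ m) * (d ∸ m))
    ≤⟨ +-monoʳ-≤ (d * d) (+-mono-≤ (*-monoˡ-≤ (d + d) (*-monoʳ-≤ 2 m≤d))
                                   (*-mono-≤ (m∸n≤m d m) (m∸n≤m d m))) ⟩
  d * d + (2 * d * (d + d) + d * d)
    ≡⟨ identity d ⟩
  6 * d ^ 2 ∎
  where
  open ≤-Reasoning
  identity : ∀ d → d * d + (2 * d * (d + d) + d * d) ≡ 6 * (d * (d * 1))
  identity = solve-∀

⟨⟩-φ : ∀ {d m} → m ≤ d → (x y : BitVec d) →
       ⟨ φˣ m x , φʸ m y ⟩ ≡ d * d + ∣ ⟨ x , y ⟩ - m ∣ * ∣ ⟨ x , y ⟩ - m ∣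
⟨⟩-φ {d} {m} m≤d x y = begin
  ⟨ φˣ m x , φʸ m y ⟩
    ≡⟨ ⟨⟩-++ (x ⊗ x) _ (y ⊗ y) _ ⟩
  ⟨ x ⊗ x , y ⊗ y ⟩
    + ⟨ (ones (2 * m) ⊗ coˣ x) ++ ones K₀² , (ones (2 * m) ⊗ coʸ y) ++ ones K₀² ⟩
    ≡⟨ cong₂ _+_ (⟨⟩-⊗ x x y y)
                 (⟨⟩-++ (ones (2 * m) ⊗ coˣ x) (ones K₀²) (ones (2 * m) ⊗ coʸ y) (ones K₀²)) ⟩
  p * p + (⟨ ones (2 * m) ⊗ coˣ x , ones (2 * m) ⊗ coʸ y ⟩ + ⟨ ones K₀² , ones K₀² ⟩)
    ≡⟨ cong (p * p +_) (cong₂ _+_ (⟨⟩-⊗ (ones (2 * m)) (coˣ x) (ones (2 * m)) (coʸ y))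
                                  (⟨⟩-ones K₀²)) ⟩
  p * p + (⟨ ones (2 * m) , ones (2 * m) ⟩ * ⟨ coˣ x , coʸ y ⟩ + K₀²)
    ≡⟨ cong (λ c → p * p + (c * ⟨ coˣ x , coʸ y ⟩ + K₀²)) (⟨⟩-ones (2 * m)) ⟩
  p * p + (2 * m * ⟨ coˣ x , coʸ y ⟩ + K₀²)
    ≡⟨ sym (+-assoc (p * p) _ K₀²) ⟩
  p * p + 2 * m * ⟨ coˣ x , coʸ y ⟩ + K₀²
    ≡⟨ square-completion {p = p} {K₀ = d ∸ m} (⟨⟩-co-+ x y) (m∸n+n≡m m≤d) ⟩
  d * d + ∣ p - m ∣ * ∣ p - m ∣ ∎
  where
  open ≡-Reasoning
  p : ℕ
  p = ⟨ x , y ⟩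
  K₀² : ℕ
  K₀² = (d ∸ m) * (d ∸ m)

lemma5p4 : ∃[ C ] ((d : ℕ) → ∃[ M ] ((m : ℕ) → m ≤ d →
               ∃[ n ] (n ≤ C * d ^ 2 ×
                 Σ (BitVec d → BitVec n) (λ φx → Σ (BitVec d → BitVec n) (λ φy →
                   (x y : BitVec d) →
                     (⟨ x , y ⟩ ≡ m → ⟨ φx x , φy y ⟩ ≡ M) ×
                     (¬ (⟨ x , y ⟩ ≡ m) → ⟨ φx x , φy y ⟩ > M))))))
lemma5p4 = 6 , λ d → d * d , λ m m≤d →
  encodingLength d m , encodingLength-≤ m≤d , φˣ m , φʸ m , λ x y →
    (λ p≡m → trans (⟨⟩-φ m≤d x y) (exact {d} (m≡n⇒∣m-n∣≡0 p≡m))) ,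
    (λ p≢m → subst (d * d <_) (sym (⟨⟩-φ m≤d x y))
               (excess {d} (n≢0⇒n>0 (contraposition ∣m-n∣≡0⇒m≡n p≢m))))
  where
  exact : ∀ {d g} → g ≡ 0 → d * d + g * g ≡ d * d
  exact {d} refl = +-identityʳ (d * d)
  excess : ∀ {d g} → g > 0 → d * d < d * d + g * g
  excess {d} g>0 = m<m+n (d * d) (*-mono-< g>0 g>0)
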